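{- Let $p\ge 3$ be a fixed integer and let $\mathscr{A}_p$ be the collection of all subsets of $\mathbb{N}=\{1,2,3,\dots\}$ containing no arithmetic progression of length $p$. For $X\in\mathscr{A}_p$ let $\mu(X)=\sum_{x\in X}\frac1x$. Assume the Erdős conjecture: every set $A\subseteq\mathbb{N}$ with $\sum_{a\in A}\frac1a=\infty$ contains arithmetic progressions of every finite length. Then there exists a set $M_p\in\mathscr{A}_p$ such that $\mu(X)\le\mu(M_p)$ for all $X\in\mathscr{A}_p$; that is, the supremum of $\{\mu(X):X\in\mathscr{A}_p\}$ is attained.
   Context: An arithmetic progression of length $p$ in a set $A$ means $p$ distinct elements $a, a+d,\dots,a+(p-1)d$ of $A$ with $d\ge1$. -}

module Defs where

open import Data.Nat as ℕ using (ℕ; zero; suc; _*_; NonZero)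
import Data.Nat
open import Data.Bool using (Bool; true; false; if_then_else_)
open import Data.Integer using (+_)
open import Data.Rational using (ℚ; 0ℚ; _/_; _≤_; _<_) renaming (_+_ to _+ℚ_)
open import Data.Product using (Σ; ∃; ∃-syntax; _×_)
open import Relation.Binary.PropositionalEquality using (_≡_)

-- A subset of ℕ = {1,2,3,...}, given by its characteristic function.
-- The value at 0 is irrelevant: membership requires n ≥ 1.
SubsetN : Set
SubsetN = ℕ → Bool

_∈_ : ℕ → SubsetN → Set
n ∈ A = NonZero n × A n ≡ true

HasAP : ℕ → SubsetN → Set
HasAP p A = ∃[ a ] ∃[ d ] (1 Data.Nat.≤ d × (∀ i → i Data.Nat.< p → (a ℕ.+ i * d) ∈ A))

APfree : ℕ → SubsetN → Set
APfree p A = HasAP p A → Data.Empty.⊥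
  where import Data.Empty

S : SubsetN → ℕ → ℚ
S A zero = 0ℚ
S A (suc k) = S A k +ℚ (if A (suc k) then (+ 1) / suc k else 0ℚ)

Diverges : SubsetN → Set
Diverges A = ∀ (B : ℚ) → ∃[ n ] (B < S A n)

-- μ X ≤ μ M (in [0,∞]) :  sup_n S X n ≤ sup_m S M m
μ≤ : SubsetN → SubsetN → Set
μ≤ X M = ∀ n (ε : ℚ) → 0ℚ < ε → ∃[ m ] (S X n ≤ S M m +ℚ ε)

ErdosConjecture : Set
ErdosConjecture = ∀ (A : SubsetN) → Diverges A → ∀ k → HasAP k A

-- law of excluded middle (ambient classical logic of the paper)
LEM : Set₁
LEM = ∀ (P : Set) → Relation.Nullary.Dec P
  where import Relation.Nullary

{-# OPTIONS --safe #-}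
-- Under Erdős's conjecture the reciprocal sums of the sets without p-term progressions converge uniformly:
-- otherwise there are AP-free sets Y_j and blocks (N_j, m_j] with N_{j+1} = 2 m_j on which the sum over
-- Y_j exceeds a fixed ε. The union Z of the pieces Y_j ∩ (N_j, m_j] has a divergent reciprocal sum, yet
-- every element of Z up to N_j is at most N_j / 2, which confines all but the first term of a (p+1)-term
-- progression in Z to a single block, giving a p-term progression in some Y_j, a contradiction.
--
-- The maximiser M is then built greedily, by excluded middle: n is put into M whenever the AP-free sets
-- agreeing with M on [1, n] still approach the supremum of μ. Being AP-free is decided by finite prefixes,
-- so M is AP-free, and by uniform convergence μ(M) attains the supremum.
module Submission where

open import Algebra.Bundles using (CommutativeMonoid)
open import Data.Bool using (Bool; true; false; if_then_else_)
open import Data.Integer as ℤ using (+_; -[1+_]; ∣_∣)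
import Data.Integer.Properties as ℤ
open import Data.Integer.Solver using (module +-*-Solver)
open import Data.Nat as ℕ using (ℕ; zero; suc; _+_; _*_; _≤_; _<_; _≤′_; ≤′-refl; ≤′-step; z≤n; s≤s)
import Data.Nat.Properties as ℕ
open import Data.Product using (∃-syntax; _×_; _,_; proj₁; proj₂)
open import Data.Rational as ℚ using (ℚ; 0ℚ; 1ℚ; _/_)
import Data.Rational.Properties as ℚ
open import Data.Rational.Unnormalised as ℚᵘ using (mkℚᵘ)
import Data.Rational.Unnormalised.Properties as ℚᵘ
open import Data.Sum using (_⊎_; inj₁; inj₂; [_,_]′)
open import Function using (_∘_)
open import Relation.Binary using (Rel; IsPreorder; tri<; tri≈; tri>)
open import Relation.Binary.PropositionalEquality
open import Relation.Nullary using (¬_; yes; no; does; contradiction)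
open import Relation.Nullary.Decidable using (decidable-stable; dec-true; dec-false)

open import Defs
open import Algebra.Properties.CommutativeSemigroup (CommutativeMonoid.commutativeSemigroup ℚ.+-0-commutativeMonoid)
  using (xy∙z≈zy∙x; xy∙z≈xz∙y)

suc-mono⇒mono : ∀ {a ℓ₁ ℓ₂} {A : Set a} {_≈_ : Rel A ℓ₁} {_≲_ : Rel A ℓ₂} →
  IsPreorder _≈_ _≲_ → (f : ℕ → A) → (∀ n → f n ≲ f (suc n)) → ∀ {m n} → m ≤ n → f m ≲ f n
suc-mono⇒mono {_≲_ = _≲_} isPreorder f step {m} m≤n = go (ℕ.≤⇒≤′ m≤n)
  where
  go : ∀ {n} → m ≤′ n → f m ≲ f n
  go ≤′-refl = IsPreorder.refl isPreorder
  go (≤′-step m≤′n) = IsPreorder.trans isPreorder (go m≤′n) (step _)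

p≤p+q : ∀ {p q} → 0ℚ ℚ.≤ q → p ℚ.≤ p ℚ.+ q
p≤p+q {p} 0≤q = subst (ℚ._≤ p ℚ.+ _) (ℚ.+-identityʳ p) (ℚ.+-monoʳ-≤ p 0≤q)

+-cancelʳ-< : ∀ {p q} r → p ℚ.+ r ℚ.< q ℚ.+ r → p ℚ.< q
+-cancelʳ-< r p+r<q+r = ℚ.≰⇒> λ q≤p → ℚ.<-irrefl refl (ℚ.<-≤-trans p+r<q+r (ℚ.+-monoˡ-≤ r q≤p))

+[1+n]/1≡+n/1+1 : ∀ n → + suc n / 1 ≡ + n / 1 ℚ.+ 1ℚ
+[1+n]/1≡+n/1+1 n = ℚ.toℚᵘ-injective (begin
  ℚ.toℚᵘ (+ suc n / 1)                ≈⟨ ℚ.toℚᵘ-fromℚᵘ (mkℚᵘ (+ suc n) 0) ⟩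
  mkℚᵘ (+ suc n) 0                    ≈⟨ ℚᵘ.*≡* numerators ⟩
  mkℚᵘ (+ n) 0 ℚᵘ.+ mkℚᵘ (+ 1) 0      ≈⟨ ℚᵘ.+-congˡ (mkℚᵘ (+ 1) 0)
                                           (ℚᵘ.≃-sym (ℚ.toℚᵘ-fromℚᵘ (mkℚᵘ (+ n) 0))) ⟩
  ℚ.toℚᵘ (+ n / 1) ℚᵘ.+ ℚ.toℚᵘ 1ℚ     ≈⟨ ℚᵘ.≃-sym (ℚ.toℚᵘ-homo-+ (+ n / 1) 1ℚ) ⟩
  ℚ.toℚᵘ (+ n / 1 ℚ.+ 1ℚ)             ∎)
  where
  open ℚᵘ.≃-Reasoning
  numerators : + suc n ℤ.* + 1 ≡ (+ n ℤ.* + 1 ℤ.+ + 1 ℤ.* + 1) ℤ.* + 1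
  numerators = solve 1 (λ x → (con (+ 1) :+ x) :* con (+ 1) := (x :* con (+ 1) :+ con (+ 1) :* con (+ 1)) :* con (+ 1))
    refl (+ n)
    where open +-*-Solver

+[1+n]/1*ε≡+n/1*ε+ε : ∀ n ε → + suc n / 1 ℚ.* ε ≡ + n / 1 ℚ.* ε ℚ.+ ε
+[1+n]/1*ε≡+n/1*ε+ε n ε = begin
  + suc n / 1 ℚ.* ε                  ≡⟨ cong (ℚ._* ε) (+[1+n]/1≡+n/1+1 n) ⟩
  (+ n / 1 ℚ.+ 1ℚ) ℚ.* ε             ≡⟨ ℚ.*-distribʳ-+ ε (+ n / 1) 1ℚ ⟩
  + n / 1 ℚ.* ε ℚ.+ 1ℚ ℚ.* ε         ≡⟨ cong (+ n / 1 ℚ.* ε ℚ.+_) (ℚ.*-identityˡ ε) ⟩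
  + n / 1 ℚ.* ε ℚ.+ ε                ∎
  where open ≡-Reasoning

q<+[1+∣↥q∣]/1 : ∀ q → q ℚ.< + suc ∣ ℚ.↥ q ∣ / 1
q<+[1+∣↥q∣]/1 q@(ℚ.mkℚ n d-1 _) = ℚ.toℚᵘ-cancel-<
  (ℚᵘ.<-respʳ-≃ (ℚᵘ.≃-sym (ℚ.toℚᵘ-fromℚᵘ (mkℚᵘ (+ suc ∣ n ∣) 0))) (ℚᵘ.*<* (n*1<[1+∣n∣]*[1+d] n)))
  where
  n*1<[1+∣n∣]*[1+d] : ∀ n → n ℤ.* + 1 ℤ.< + suc ∣ n ∣ ℤ.* + suc d-1
  n*1<[1+∣n∣]*[1+d] (+ m) rewrite ℤ.*-identityʳ (+ m) =
    ℤ.+<+ (s≤s (ℕ.≤-trans (ℕ.m≤m*n m (suc d-1)) (ℕ.m≤n+m _ d-1)))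
  n*1<[1+∣n∣]*[1+d] -[1+ m ] = ℤ.-<+

archimedean : ∀ B {ε} → 0ℚ ℚ.< ε → ∃[ j ] B ℚ.< + j / 1 ℚ.* ε
archimedean B {ε} ε>0 = suc ∣ ℚ.↥ q ∣ , (begin-strict
  B                          ≡⟨ sym q*ε≡B ⟩
  q ℚ.* ε                    <⟨ ℚ.*-monoˡ-<-pos ε (q<+[1+∣↥q∣]/1 q) ⟩
  + suc ∣ ℚ.↥ q ∣ / 1 ℚ.* ε  ∎)
  where
  open ℚ.≤-Reasoning
  instance
    ε-positive : ℚ.Positive ε
    ε-positive = ℚ.positive ε>0
    ε-nonZero : ℚ.NonZero ε
    ε-nonZero = ℚ.pos⇒nonZero ε
  q : ℚ
  q = B ℚ.÷ ε
  q*ε≡B : q ℚ.* ε ≡ B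
  q*ε≡B = trans (ℚ.*-assoc B (ℚ.1/ ε) ε) (trans (cong (B ℚ.*_) (ℚ.*-inverseˡ ε)) (ℚ.*-identityʳ B))

increasing-by-ε⇒unbounded : ∀ {ε} (f : ℕ → ℚ) → 0ℚ ℚ.< ε → 0ℚ ℚ.≤ f 0 →
  (∀ j → f j ℚ.+ ε ℚ.≤ f (suc j)) → ∀ B → ∃[ j ] B ℚ.< f j
increasing-by-ε⇒unbounded {ε} f ε>0 0≤f0 step B with archimedean B ε>0
... | j , B<jε = j , ℚ.<-≤-trans B<jε (multiple≤ j)
  where
  open ℚ.≤-Reasoning
  multiple≤ : ∀ j → + j / 1 ℚ.* ε ℚ.≤ f j
  multiple≤ zero = subst (ℚ._≤ f 0) (sym (ℚ.*-zeroˡ ε)) 0≤f0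
  multiple≤ (suc j) = begin
    + suc j / 1 ℚ.* ε      ≡⟨ +[1+n]/1*ε≡+n/1*ε+ε j ε ⟩
    + j / 1 ℚ.* ε ℚ.+ ε    ≤⟨ ℚ.+-monoˡ-≤ ε (multiple≤ j) ⟩
    f j ℚ.+ ε              ≤⟨ step j ⟩
    f (suc j)              ∎

S-suc-mono : ∀ A k → S A k ℚ.≤ S A (suc k)
S-suc-mono A k with A (suc k)
... | true  = p≤p+q (ℚ.nonNegative⁻¹ _ {{ℚ.normalize-nonNeg 1 (suc k)}})
... | false = p≤p+q ℚ.≤-refl

S-mono : ∀ A {m n} → m ≤ n → S A m ℚ.≤ S A n
S-mono A = suc-mono⇒mono ℚ.≤-isPreorder (S A) (S-suc-mono A)

S-cancel-< : ∀ A {m n} → S A m ℚ.< S A n → m < n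
S-cancel-< A Sm<Sn = ℕ.≰⇒> λ n≤m → ℚ.<-irrefl refl (ℚ.<-≤-trans Sm<Sn (S-mono A n≤m))

AgreeOn : ℕ → ℕ → SubsetN → SubsetN → Set
AgreeOn l h A B = ∀ x → l < x → x ≤ h → A x ≡ B x

-- S A h - S A l ≡ S B h - S B l, stated without subtraction.
S-block-cong : ∀ {A B l h} → l ≤ h → AgreeOn l h A B → S A h ℚ.+ S B l ≡ S B h ℚ.+ S A l
S-block-cong {A} {B} {l} l≤h = go (ℕ.≤⇒≤′ l≤h)
  where
  go : ∀ {h} → l ≤′ h → AgreeOn l h A B → S A h ℚ.+ S B l ≡ S B h ℚ.+ S A l
  go ≤′-refl _ = ℚ.+-comm (S A l) (S B l)
  go (≤′-step {h} l≤′h) A≐B = begin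
    (S A h ℚ.+ term A) ℚ.+ S B l   ≡⟨ xy∙z≈xz∙y (S A h) (term A) (S B l) ⟩
    (S A h ℚ.+ S B l) ℚ.+ term A   ≡⟨ cong₂ ℚ._+_ (go l≤′h (λ x l<x x≤h → A≐B x l<x (ℕ.m≤n⇒m≤1+n x≤h)))
                                                  same-term ⟩
    (S B h ℚ.+ S A l) ℚ.+ term B   ≡⟨ xy∙z≈xz∙y (S B h) (S A l) (term B) ⟩
    (S B h ℚ.+ term B) ℚ.+ S A l   ∎
    where
    open ≡-Reasoning
    term : SubsetN → ℚ
    term C = if C (suc h) then + 1 / suc h else 0ℚ
    same-term : term A ≡ term B
    same-term = cong (λ b → if b then + 1 / suc h else 0ℚ) (A≐B (suc h) (s≤s (ℕ.≤′⇒≤ l≤′h)) ℕ.≤-refl)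

S-cong : ∀ {A B k} → AgreeOn 0 k A B → S A k ≡ S B k
S-cong A≐B = subst₂ _≡_ (ℚ.+-identityʳ _) (ℚ.+-identityʳ _) (S-block-cong z≤n A≐B)

S-increment-cong : ∀ {A B l h c} → l ≤ h → AgreeOn l h A B →
  S A l ℚ.+ c ℚ.< S A h → S B l ℚ.+ c ℚ.< S B h
S-increment-cong {A} {B} {l} {h} {c} l≤h A≐B increment = +-cancelʳ-< (S A l) (begin-strict
  S B l ℚ.+ c ℚ.+ S A l   ≡⟨ xy∙z≈zy∙x (S B l) c (S A l) ⟩
  S A l ℚ.+ c ℚ.+ S B l   <⟨ ℚ.+-monoˡ-< (S B l) increment ⟩
  S A h ℚ.+ S B l         ≡⟨ S-block-cong l≤h A≐B ⟩
  S B h ℚ.+ S A l         ∎)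
  where open ℚ.≤-Reasoning

∅ : SubsetN
∅ _ = false

∅-APfree : ∀ p → APfree (suc p) ∅
∅-APfree p (_ , _ , _ , in∅) with in∅ 0 (s≤s z≤n)
... | _ , ()

_[_]≔_ : SubsetN → ℕ → Bool → SubsetN
(A [ k ]≔ b) x with x ℕ.≟ k
... | yes _ = b
... | no  _ = A x

[]≔-other : ∀ A {k x} b → x ≢ k → (A [ k ]≔ b) x ≡ A x
[]≔-other A {k} {x} b x≢k with x ℕ.≟ k
... | yes x≡k = contradiction x≡k x≢k
... | no  _   = refl

[]≔-agreeOn : ∀ {τ Y k b} → AgreeOn 0 k τ Y → Y (suc k) ≡ b → AgreeOn 0 (suc k) (τ [ suc k ]≔ b) Y
[]≔-agreeOn {k = k} τ≐Y Y[1+k]≡b x 0<x x≤1+k with x ℕ.≟ suc k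
... | yes refl = sym Y[1+k]≡b
... | no  x≢1+k = τ≐Y x 0<x (ℕ.s≤s⁻¹ (ℕ.≤∧≢⇒< x≤1+k x≢1+k))

module _ (F : SubsetN → Set) where

  Reaches : ℕ → SubsetN → ℚ → Set
  Reaches k τ c = ∃[ Y ] (F Y × AgreeOn 0 k τ Y × ∃[ m ] c ℚ.≤ S Y m)

  -- The members of F that agree with τ on (0, k] have the same supremum of μ as all of F.
  Maximising : ℕ → SubsetN → Set
  Maximising k τ = ∀ X → F X → ∀ n → Reaches k τ (S X n)

module _ {F : SubsetN → Set} where

  reaches-antitone : ∀ {k τ c c′} → c′ ℚ.≤ c → Reaches F k τ c → Reaches F k τ c′
  reaches-antitone c′≤c (Y , Y∈F , τ≐Y , m , c≤Ym) = Y , Y∈F , τ≐Y , m , ℚ.≤-trans c′≤c c≤Ym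

  reaches-split : ∀ {k τ c} → Reaches F k τ c →
    Reaches F (suc k) (τ [ suc k ]≔ true) c ⊎ Reaches F (suc k) (τ [ suc k ]≔ false) c
  reaches-split {k} (Y , Y∈F , τ≐Y , m , c≤Ym) with Y (suc k) in Y[1+k]
  ... | true  = inj₁ (Y , Y∈F , []≔-agreeOn τ≐Y Y[1+k] , m , c≤Ym)
  ... | false = inj₂ (Y , Y∈F , []≔-agreeOn τ≐Y Y[1+k] , m , c≤Ym)

  maximising-zero : ∀ τ → Maximising F 0 τ
  maximising-zero τ X X∈F n = X , X∈F , (λ x 0<x x≤0 → contradiction x≤0 (ℕ.<⇒≱ 0<x)) , n , ℚ.≤-refl

  maximising-cong : ∀ {k τ τ′} → AgreeOn 0 k τ τ′ → Maximising F k τ → Maximising F k τ′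
  maximising-cong τ≐τ′ max X X∈F n with max X X∈F n
  ... | Y , Y∈F , τ≐Y , m , Xn≤Ym =
    Y , Y∈F , (λ x 0<x x≤k → trans (sym (τ≐τ′ x 0<x x≤k)) (τ≐Y x 0<x x≤k)) , m , Xn≤Ym

  -- If the extension by true missed S X₁ n₁ and the one by false missed S X₀ n₀, whichever extension
  -- reaches the larger of the two values would reach both.
  maximising-split : LEM → ∀ {k τ} → Maximising F k τ → ∃[ b ] Maximising F (suc k) (τ [ suc k ]≔ b)
  maximising-split em {k} {τ} max with em (Maximising F (suc k) (τ [ suc k ]≔ true))
  ... | yes max⁺ = true , max⁺
  ... | no ¬max⁺ = false , λ X₀ X₀∈F n₀ → decidable-stable (em _) λ ¬reach⁻ →
    ¬max⁺ λ X₁ X₁∈F n₁ → decidable-stable (em _) λ ¬reach⁺ →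
      [ (λ c₁≤c₀ → [ ¬reach⁺ ∘ reaches-antitone c₁≤c₀ , ¬reach⁻ ]′ (reaches-split (max X₀ X₀∈F n₀)))
      , (λ c₀≤c₁ → [ ¬reach⁺ , ¬reach⁻ ∘ reaches-antitone c₀≤c₁ ]′ (reaches-split (max X₁ X₁∈F n₁)))
      ]′ (ℚ.≤-total (S X₁ n₁) (S X₀ n₀))

greedy-limit : LEM → ∀ F → ∃[ M ] (∀ k → Maximising F k M)
greedy-limit em F = limit , λ k → maximising-cong (prefix-agrees k) (prefix-maximising k)
  where
  prefix : ℕ → SubsetN
  prefix-maximising : ∀ k → Maximising F k (prefix k)
  prefix zero = ∅
  prefix (suc k) = prefix k [ suc k ]≔ proj₁ (maximising-split em (prefix-maximising k))
  prefix-maximising zero = maximising-zero ∅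
  prefix-maximising (suc k) = proj₂ (maximising-split em (prefix-maximising k))

  limit : SubsetN
  limit x = prefix x x

  prefix-stable : ∀ {x k} → x ≤′ k → prefix k x ≡ limit x
  prefix-stable ≤′-refl = refl
  prefix-stable {x} (≤′-step {k} x≤′k) =
    trans ([]≔-other (prefix k) _ (ℕ.<⇒≢ (s≤s (ℕ.≤′⇒≤ x≤′k)))) (prefix-stable x≤′k)

  prefix-agrees : ∀ k → AgreeOn 0 k (prefix k) limit
  prefix-agrees k x _ x≤k = prefix-stable (ℕ.≤⇒≤′ x≤k)

APfree-closed : ∀ {p M} → (∀ k → ∃[ Y ] (APfree p Y × AgreeOn 0 k M Y)) → APfree p M
APfree-closed {p} approx (a , d , d≥1 , inM) with approx (a + p * d)
... | Y , Y-free , M≐Y = Y-free (a , d , d≥1 , inY)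
  where
  inY : ∀ i → i < p → (a + i * d) ∈ Y
  inY i i<p with inM i i<p
  ... | nonZero , M[a+id] = nonZero , trans (sym (M≐Y _ (ℕ.>-nonZero⁻¹ _ {{nonZero}}) a+id≤a+pd)) M[a+id]
    where
    a+id≤a+pd : a + i * d ≤ a + p * d
    a+id≤a+pd = ℕ.+-monoʳ-≤ a (ℕ.*-monoˡ-≤ d (ℕ.<⇒≤ i<p))

ap-step≤double : ∀ a d {i} → 1 ≤ i → a + suc i * d ≤ (a + i * d) + (a + i * d)
ap-step≤double a d {i} 1≤i = begin
  a + (d + i * d)          ≡⟨ cong (_+_ a) (ℕ.+-comm d (i * d)) ⟩
  a + (i * d + d)          ≡⟨ ℕ.+-assoc a (i * d) d ⟨
  (a + i * d) + d          ≤⟨ ℕ.+-monoʳ-≤ (a + i * d) d≤a+id ⟩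
  (a + i * d) + (a + i * d) ∎
  where
  open ℕ.≤-Reasoning
  d≤a+id : d ≤ a + i * d
  d≤a+id = ℕ.≤-trans (ℕ.m≤n*m d i {{ℕ.>-nonZero 1≤i}}) (ℕ.m≤n+m (i * d) a)

SparseBelow : SubsetN → ℕ → Set
SparseBelow A B = ∀ {x} → A x ≡ true → x ≤ B → x + x ≤ B

ap-trapped-below : ∀ {A B a d i p} → SparseBelow A B → (∀ j → j ≤ p → A (a + j * d) ≡ true) →
  1 ≤ i → i ≤ p → a + i * d ≤ B → a + p * d ≤ B
ap-trapped-below {A} {B} {a} {d} {i} sparse inA 1≤i i≤p below = go (ℕ.≤⇒≤′ i≤p) inA
  where
  go : ∀ {p} → i ≤′ p → (∀ j → j ≤ p → A (a + j * d) ≡ true) → a + p * d ≤ B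
  go ≤′-refl _ = below
  go (≤′-step {p} i≤′p) inA = ℕ.≤-trans (ap-step≤double a d (ℕ.≤-trans 1≤i (ℕ.≤′⇒≤ i≤′p)))
    (sparse (inA p (ℕ.n≤1+n p)) (go i≤′p (λ j j≤p → inA j (ℕ.m≤n⇒m≤1+n j≤p))))

module Gluing (em : LEM) (X : ℕ → SubsetN) (lo hi : ℕ → ℕ)
              (lo<hi : ∀ j → lo j < hi j) (spaced : ∀ j → hi j + hi j ≤ lo (suc j)) where

  InBlock : ℕ → Set
  InBlock x = ∃[ j ] (lo j < x × x ≤ hi j × X j x ≡ true)

  glued : SubsetN
  glued x = does (em (InBlock x))

  lo-mono : ∀ {j j′} → j ≤ j′ → lo j ≤ lo j′
  lo-mono = suc-mono⇒mono ℕ.≤-isPreorder lo λ j →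
    ℕ.≤-trans (ℕ.<⇒≤ (lo<hi j)) (ℕ.≤-trans (ℕ.m≤m+n (hi j) (hi j)) (spaced j))

  hi<lo : ∀ {j j′} → j < j′ → hi j < lo j′
  hi<lo {j} j<j′ = ℕ.<-≤-trans (ℕ.m<m+n (hi j) (ℕ.≤-<-trans z≤n (lo<hi j)))
    (ℕ.≤-trans (spaced j) (lo-mono j<j′))

  block-unique : ∀ {j j′ x} → lo j < x → x ≤ hi j → lo j′ < x → x ≤ hi j′ → j ≡ j′
  block-unique {j} {j′} lo<x x≤hi lo′<x x≤hi′ with ℕ.<-cmp j j′
  ... | tri< j<j′ _ _ = contradiction (ℕ.<-trans (ℕ.≤-<-trans x≤hi (hi<lo j<j′)) lo′<x) (ℕ.<-irrefl refl)
  ... | tri≈ _ j≡j′ _ = j≡j′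
  ... | tri> _ _ j′<j = contradiction (ℕ.<-trans (ℕ.≤-<-trans x≤hi′ (hi<lo j′<j)) lo<x) (ℕ.<-irrefl refl)

  glued-agrees : ∀ {j x} → lo j < x → x ≤ hi j → glued x ≡ X j x
  glued-agrees {j} {x} lo<x x≤hi with X j x in Xjx
  ... | true  = dec-true (em _) (j , lo<x , x≤hi , Xjx)
  ... | false = dec-false (em _) λ (j′ , lo′<x , x≤hi′ , Xj′x) →
    let j≡j′ = block-unique lo<x x≤hi lo′<x x≤hi′
    in contradiction (trans (sym Xjx) (subst (λ i → X i x ≡ true) (sym j≡j′) Xj′x)) λ ()

  glued-inBlock : ∀ {x} → glued x ≡ true → InBlock x
  glued-inBlock {x} x∈glued with em (InBlock x)
  ... | yes inBlock = inBlock

  glued-sparse : ∀ j → SparseBelow glued (lo j)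
  glued-sparse j {x} x∈glued x≤lo with glued-inBlock x∈glued
  ... | j′ , lo′<x , x≤hi′ , _ with j′ ℕ.<? j
  ... | yes j′<j = ℕ.≤-trans (ℕ.+-mono-≤ x≤hi′ x≤hi′) (ℕ.≤-trans (spaced j′) (lo-mono j′<j))
  ... | no  j′≮j = contradiction (ℕ.≤-<-trans (lo-mono (ℕ.≮⇒≥ j′≮j)) lo′<x) (ℕ.≤⇒≯ x≤lo)

  -- Sparseness keeps every term after the first in the block of the last term, where glued is X j.
  glued-APfree : ∀ {p} → (∀ j → APfree p (X j)) → APfree (suc p) glued
  glued-APfree {p} X-free (a , d , d≥1 , in-glued) with glued-inBlock (proj₂ (in-glued p ℕ.≤-refl))
  ... | j , lo<last , last≤hi , _ = X-free j (a + d , d , d≥1 , λ i i<p →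
    subst (_∈ X j) (sym (ℕ.+-assoc a d (i * d))) (inX (s≤s z≤n) i<p))
    where
    above-lo : ∀ {i} → 1 ≤ i → i ≤ p → lo j < a + i * d
    above-lo 1≤i i≤p = ℕ.≰⇒> λ below → ℕ.<⇒≱ lo<last
      (ap-trapped-below (glued-sparse j) (λ i i≤p → proj₂ (in-glued i (s≤s i≤p))) 1≤i i≤p below)
    inX : ∀ {i} → 1 ≤ i → i ≤ p → (a + i * d) ∈ X j
    inX {i} 1≤i i≤p with in-glued i (s≤s i≤p)
    ... | nonZero , in-glued-i = nonZero , trans (sym (glued-agrees (above-lo 1≤i i≤p)
      (ℕ.≤-trans (ℕ.+-monoʳ-≤ a (ℕ.*-monoˡ-≤ d i≤p)) last≤hi))) in-glued-i

  glued-increment : ∀ j {c} → S (X j) (lo j) ℚ.+ c ℚ.< S (X j) (hi j) → S glued (lo j) ℚ.+ c ℚ.< S glued (hi j)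
  glued-increment j = S-increment-cong (ℕ.<⇒≤ (lo<hi j)) λ x lo<x x≤hi → sym (glued-agrees lo<x x≤hi)

Escaping : (SubsetN → Set) → ℚ → Set
Escaping F ε = ∀ N → ∃[ Y ] (F Y × ∃[ m ] (S Y N ℚ.+ ε ℚ.< S Y m))

APfree-not-escaping : LEM → ErdosConjecture → ∀ p {ε} → 0ℚ ℚ.< ε → ¬ Escaping (APfree p) ε
APfree-not-escaping em erdős p {ε} ε>0 escape =
  glued-APfree (λ j → proj₁ (proj₂ (escape (lo j)))) (erdős glued glued-diverges (suc p))
  where
  lo hi : ℕ → ℕ
  lo zero = 0
  lo (suc j) = hi j + hi j
  hi j = proj₁ (proj₂ (proj₂ (escape (lo j))))

  X : ℕ → SubsetN
  X j = proj₁ (escape (lo j))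

  escapes : ∀ j → S (X j) (lo j) ℚ.+ ε ℚ.< S (X j) (hi j)
  escapes j = proj₂ (proj₂ (proj₂ (escape (lo j))))

  lo<hi : ∀ j → lo j < hi j
  lo<hi j = S-cancel-< (X j) (ℚ.≤-<-trans (p≤p+q (ℚ.<⇒≤ ε>0)) (escapes j))

  open Gluing em X lo hi lo<hi (λ _ → ℕ.≤-refl)

  glued-grows : ∀ j → S glued (lo j) ℚ.+ ε ℚ.≤ S glued (lo (suc j))
  glued-grows j = ℚ.≤-trans (ℚ.<⇒≤ (glued-increment j (escapes j))) (S-mono glued (ℕ.m≤m+n (hi j) (hi j)))

  glued-diverges : Diverges glued
  glued-diverges B with increasing-by-ε⇒unbounded (S glued ∘ lo) ε>0 ℚ.≤-refl glued-grows B
  ... | j , B<sum = lo j , B<sum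

UniformlyConvergent : (SubsetN → Set) → Set
UniformlyConvergent F = ∀ {ε} → 0ℚ ℚ.< ε → ∃[ K ] (∀ Y → F Y → ∀ m → S Y m ℚ.≤ S Y K ℚ.+ ε)

APfree-uniformlyConvergent : LEM → ErdosConjecture → ∀ p → UniformlyConvergent (APfree p)
APfree-uniformlyConvergent em erdős p ε>0 = decidable-stable (em _) λ ¬uniform →
  APfree-not-escaping em erdős p ε>0 λ N → decidable-stable (em _) λ ¬escape →
    ¬uniform (N , λ Y Y-free m → ℚ.≮⇒≥ λ N+ε<m → ¬escape (Y , Y-free , m , N+ε<m))

maximising⇒μ≤ : ∀ {F M} → UniformlyConvergent F → (∀ k → Maximising F k M) → ∀ X → F X → μ≤ X M
maximising⇒μ≤ {M = M} uniform max X X∈F n ε ε>0 with uniform ε>0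
... | K , tail with max K X X∈F n
... | Y , Y∈F , M≐Y , m , Xn≤Ym = K , (begin
  S X n          ≤⟨ Xn≤Ym ⟩
  S Y m          ≤⟨ tail Y Y∈F m ⟩
  S Y K ℚ.+ ε    ≡⟨ cong (ℚ._+ ε) (S-cong M≐Y) ⟨
  S M K ℚ.+ ε    ∎)
  where open ℚ.≤-Reasoning

corollary3 : LEM → ErdosConjecture → (p : ℕ) → 3 ≤ p →
    ∃[ M ] (APfree p M × (∀ X → APfree p X → μ≤ X M))
corollary3 em erdős (suc p) _ with greedy-limit em (APfree (suc p))
... | M , maximising =
  M , APfree-closed approximants , maximising⇒μ≤ (APfree-uniformlyConvergent em erdős (suc p)) maximising
  where
  approximants : ∀ k → ∃[ Y ] (APfree (suc p) Y × AgreeOn 0 k M Y)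
  approximants k with maximising k ∅ (∅-APfree p) 0
  ... | Y , Y-free , M≐Y , _ = Y , Y-free , M≐Y
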